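{- If $\mathcal C$ is an inductively pierced code, then $\Delta(\mathcal C)$ is a disjoint union of collapsible simplicial complexes.
   Context: A neural code on $n$ neurons is a set $\mathcal C\subseteq 2^{[n]}$. Its simplicial complex $\Delta(\mathcal C)$ is the smallest simplicial complex containing $\mathcal C$. A face $\tau$ of $\Delta$ strictly contained in a facet $\sigma$ is free if it is contained in no other facet; an elementary collapse removes all faces $\lambda$ with $\tau\subseteq\lambda\subseteq\sigma$ for such a free face $\tau$. $\Delta$ is collapsible if a sequence of elementary collapses reduces it to a point. Piercing: let $\mathcal C$ be a code on $[n]$ and $(\lambda,\sigma,\tau)$ a partition of $[n]$ into three disjoint (possibly empty) sets with $|\lambda|=j$. $\mathcal C$ is $(\lambda,\sigma,\tau)$-pierceable if $\sigma\cup\nu\in\mathcal C$ for every $\nu\subseteq\lambda$; then the $j$-piercing is the code on $[n+1]$ given by $\mathcal C\cup\{\sigma\cup\nu\cup\{n+1\}:\nu\subseteq\lambda\}$. A code is inductively $k$-pierced if it is $\{\varnothing,\{1\}\}$ or is obtained from an inductively $k$-pierced code on $n-1$ neurons by a $j$-piercing with $j\le k$. A code is inductively pierced if it is inductively $k$-pierced for some $k\ge0$. -}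

module Defs where

open import Level using (0ℓ)
open import Data.Nat using (ℕ; suc; _≤_)
open import Data.Bool using (true; false)
open import Data.Fin using (Fin; zero)
open import Data.Fin.Subset using (Subset; _⊆_; _∪_; _∩_; ⁅_⁆; ∣_∣; Nonempty; Empty; inside; outside)
import Data.Fin.Subset as S
open import Data.Vec using (_∷ʳ_)
open import Data.List using (List)
open import Data.List.Relation.Unary.All using (All)
open import Data.List.Relation.Unary.Any using (Any)
open import Data.List.Relation.Unary.AllPairs using (AllPairs)
open import Data.Product using (Σ; ∃; ∃-syntax; _×_)
open import Data.Sum using (_⊎_)
open import Relation.Nullary using (¬_)
open import Relation.Binary.PropositionalEquality using (_≡_; _≢_)
open import Relation.Binary.Construct.Closure.ReflexiveTransitive using (Star)
open import Function.Bundles using (_⇔_)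

Code : ℕ → Set₁
Code n = Subset n → Set

-- A (finite) simplicial complex on vertex set Fin n, given by its set of faces.
-- Only nonempty faces are relevant (the empty face is ignored throughout).
Complex : ℕ → Set₁
Complex n = Subset n → Set

Δ : ∀ {n} → Code n → Complex n
Δ C s = ∃[ c ] (C c × s ⊆ c)

Facet : ∀ {n} → Complex n → Subset n → Set
Facet K σ = Nonempty σ × K σ × (∀ ρ → K ρ → σ ⊆ ρ → ρ ≡ σ)

ElemCollapse : ∀ {n} → Complex n → Complex n → Set
ElemCollapse {n} K K' =
  Σ (Subset n) λ σ → Σ (Subset n) λ τ →
    Facet K σ × Nonempty τ × τ ⊆ σ × τ ≢ σ ×
    (∀ ρ → Facet K ρ → τ ⊆ ρ → ρ ≡ σ) ×
    (∀ s → Nonempty s → (K' s ⇔ (K s × ¬ (τ ⊆ s × s ⊆ σ))))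

IsPoint : ∀ {n} → Complex n → Set
IsPoint {n} K = ∃[ v ] (∀ s → Nonempty s → (K s ⇔ (s ≡ ⁅ v ⁆)))

Collapsible : ∀ {n} → Complex n → Set₁
Collapsible {n} K = ∃[ K' ] (Star ElemCollapse K K' × IsPoint K')

VertexDisjoint : ∀ {n} → Complex n → Complex n → Set
VertexDisjoint K L = ∀ s t → K s → L t → Empty (s ∩ t)

DisjointUnionOfCollapsible : ∀ {n} → Complex n → Set₁
DisjointUnionOfCollapsible {n} K =
  Σ (List (Complex n)) λ Ks →
    All Collapsible Ks ×
    AllPairs VertexDisjoint Ks ×
    (∀ s → Nonempty s → (K s ⇔ Any (λ L → L s) Ks))

-- (λ,σ,τ)-pierceability; τ is the complement of λ ∪ σ, so only λ ∩ σ = ∅ is required.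
Pierceable : ∀ {n} → Code n → (l σ : Subset n) → Set
Pierceable C l σ = Empty (l ∩ σ) × (∀ ν → ν ⊆ l → C (σ ∪ ν))

-- The piercing code on n+1 neurons (new neuron n+1 is the last coordinate).
Piercing : ∀ {n} → Code n → (l σ : Subset n) → Code (suc n)
Piercing {n} C l σ w =
  (∃[ s ] (w ≡ s ∷ʳ outside × C s)) ⊎
  (∃[ ν ] (ν ⊆ l × w ≡ (σ ∪ ν) ∷ʳ inside))

-- Inductively k-pierced codes (taken up to pointwise equivalence of predicates).
data IndPierced (k : ℕ) : (n : ℕ) → Code n → Set₁ where
  base : (C : Code 1) → (∀ w → C w ⇔ (w ≡ S.⊥ ⊎ w ≡ ⁅ zero ⁆)) → IndPierced k 1 C
  pierce : ∀ {n} (C : Code n) → IndPierced k n C → (l σ : Subset n) →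
           Pierceable C l σ → ∣ l ∣ ≤ k →
           (C' : Code (suc n)) → (∀ w → C' w ⇔ Piercing C l σ w) →
           IndPierced k (suc n) C'

InductivelyPierced : ∀ {n} → Code n → Set₁
InductivelyPierced {n} C = ∃[ k ] IndPierced k n C

-- A piercing of C along (λ, σ, τ) adds the codewords σ ∪ ν ∪ {n+1} (ν ⊆ λ), all
-- contained in σ ∪ λ ∪ {n+1}, while σ ∪ λ is already a codeword of C. Hence
-- Δ(C') = Δ(C) ∪ ({n+1} ∗ simplex(σ ∪ λ)), the cone from the new vertex over
-- the face σ ∪ λ of Δ(C). If σ ∪ λ = ∅ this just adds an isolated vertex.
-- Otherwise σ ∪ λ lies in exactly one component K of Δ(C), and the cone over
-- K collapses back onto K through the free face {n+1} ⊊ σ ∪ λ ∪ {n+1}; the new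
-- vertex meets no other component.
module Submission where

open import Defs
open import Data.Nat using (ℕ; suc)
open import Data.Bool using (Bool)
open import Data.Fin using (Fin; zero; suc; inject₁; fromℕ)
open import Data.Fin.Subset
  using (Subset; _⊆_; _∪_; _∩_; ⁅_⁆; Nonempty; Empty; inside; outside; _∈_)
import Data.Fin.Subset as S
open import Data.Fin.Subset.Properties
  using (∉⊥; ⊥⊆; ⊆-refl; ⊆-antisym; ⊆-trans; x∈⁅x⁆; ∩-comm; x∈p∩q⁻; x∈p∩q⁺;
         x∈p∪q⁻; x∈p∪q⁺; nonempty?; Empty-unique)
open import Data.Vec using ([]; _∷_; _∷ʳ_; here; there; initLast)
open import Data.Vec.Properties using (∷ʳ-injective; ∷ʳ-injectiveˡ)
open import Data.List using (List; []; _∷_; map)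
open import Data.List.Relation.Unary.All as All using (All; []; _∷_)
import Data.List.Relation.Unary.All.Properties as All
open import Data.List.Relation.Unary.Any using (Any; here; there)
open import Data.List.Relation.Unary.AllPairs as AllPairs using (AllPairs; []; _∷_)
import Data.List.Relation.Unary.AllPairs.Properties as AllPairs
open import Data.Product using (∃-syntax; _×_; _,_; proj₁; proj₂)
open import Data.Sum using (_⊎_; inj₁; inj₂)
open import Function using (_∘_; id)
open import Function.Bundles using (_⇔_; mk⇔; Equivalence)
open import Function.Properties.Equivalence using () renaming (trans to ⇔-trans)
open import Relation.Nullary using (¬_; yes; no; contradiction)
open import Relation.Binary.PropositionalEquality using (_≡_; _≢_; refl; sym; trans; cong; subst)
open import Relation.Binary.Construct.Closure.ReflexiveTransitive using (Star; ε; _◅_)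

open Equivalence

private
  variable
    n : ℕ
    b c : Bool
    s s' t ν σ l M : Subset n
    K K' L : Complex n

-- Subsets of Fin (suc n) as t ∷ʳ b, the last bit being the new neuron

inject₁-or-fromℕ : (y : Fin (suc n)) → (∃[ x ] y ≡ inject₁ x) ⊎ y ≡ fromℕ n
inject₁-or-fromℕ {ℕ.zero} zero = inj₂ refl
inject₁-or-fromℕ {suc n} zero = inj₁ (zero , refl)
inject₁-or-fromℕ {suc n} (suc y) with inject₁-or-fromℕ y
... | inj₁ (x , refl) = inj₁ (suc x , refl)
... | inj₂ refl = inj₂ refl

inject₁∈∷ʳ⁺ : {x : Fin n} → x ∈ s → inject₁ x ∈ s ∷ʳ b
inject₁∈∷ʳ⁺ {s = _ ∷ _} here = here
inject₁∈∷ʳ⁺ {s = _ ∷ _} (there p) = there (inject₁∈∷ʳ⁺ p)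

inject₁∈∷ʳ⁻ : {x : Fin n} → inject₁ x ∈ s ∷ʳ b → x ∈ s
inject₁∈∷ʳ⁻ {s = _ ∷ _} {x = zero} here = here
inject₁∈∷ʳ⁻ {s = _ ∷ _} {x = suc x} (there p) = there (inject₁∈∷ʳ⁻ p)

fromℕ∈∷ʳ⁺ : fromℕ n ∈ s ∷ʳ inside
fromℕ∈∷ʳ⁺ {s = []} = here
fromℕ∈∷ʳ⁺ {s = _ ∷ _} = there fromℕ∈∷ʳ⁺

fromℕ∈∷ʳ⁻ : fromℕ n ∈ s ∷ʳ b → b ≡ inside
fromℕ∈∷ʳ⁻ {s = []} here = refl
fromℕ∈∷ʳ⁻ {s = _ ∷ _} (there p) = fromℕ∈∷ʳ⁻ p

∷ʳ-mono : s ⊆ t → s ∷ʳ b ⊆ t ∷ʳ b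
∷ʳ-mono s⊆t {y} p with inject₁-or-fromℕ y
... | inj₁ (x , refl) = inject₁∈∷ʳ⁺ (s⊆t (inject₁∈∷ʳ⁻ p))
... | inj₂ refl with fromℕ∈∷ʳ⁻ p
... | refl = fromℕ∈∷ʳ⁺

drop-∷ʳ-⊆ : s ∷ʳ b ⊆ t ∷ʳ c → s ⊆ t
drop-∷ʳ-⊆ h p = inject₁∈∷ʳ⁻ (h (inject₁∈∷ʳ⁺ p))

∷ʳ-inside-⊆ : s ∷ʳ inside ⊆ t ∷ʳ c → c ≡ inside
∷ʳ-inside-⊆ h = fromℕ∈∷ʳ⁻ (h fromℕ∈∷ʳ⁺)

∷ʳ-Nonempty⁺ : Nonempty s → Nonempty (s ∷ʳ b)
∷ʳ-Nonempty⁺ (x , p) = inject₁ x , inject₁∈∷ʳ⁺ p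

∷ʳ-outside-Nonempty⁻ : Nonempty (s ∷ʳ outside) → Nonempty s
∷ʳ-outside-Nonempty⁻ (y , p) with inject₁-or-fromℕ y
... | inj₁ (x , refl) = x , inject₁∈∷ʳ⁻ p
... | inj₂ refl = contradiction (fromℕ∈∷ʳ⁻ p) λ ()

∷ʳ-outside-∩-Nonempty⁻ : Nonempty ((s ∷ʳ b) ∩ (t ∷ʳ outside)) → Nonempty (s ∩ t)
∷ʳ-outside-∩-Nonempty⁻ {s = s} {b = b} {t = t} (y , p)
  with x∈p∩q⁻ (s ∷ʳ b) (t ∷ʳ outside) p | inject₁-or-fromℕ y
... | p₁ , p₂ | inj₁ (x , refl) = x , x∈p∩q⁺ (inject₁∈∷ʳ⁻ p₁ , inject₁∈∷ʳ⁻ p₂)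
... | _ , p₂ | inj₂ refl = contradiction (fromℕ∈∷ʳ⁻ p₂) λ ()

⊥-∷ʳ : S.⊥ {suc n} ≡ S.⊥ {n} ∷ʳ outside
⊥-∷ʳ {ℕ.zero} = refl
⊥-∷ʳ {suc n} = cong (outside ∷_) ⊥-∷ʳ

⁅inject₁⁆-∷ʳ : (v : Fin n) → ⁅ inject₁ v ⁆ ≡ ⁅ v ⁆ ∷ʳ outside
⁅inject₁⁆-∷ʳ zero = cong (inside ∷_) ⊥-∷ʳ
⁅inject₁⁆-∷ʳ (suc v) = cong (outside ∷_) (⁅inject₁⁆-∷ʳ v)

⁅fromℕ⁆-∷ʳ : ∀ n → ⁅ fromℕ n ⁆ ≡ S.⊥ {n} ∷ʳ inside
⁅fromℕ⁆-∷ʳ ℕ.zero = refl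
⁅fromℕ⁆-∷ʳ (suc n) = cong (outside ∷_) (⁅fromℕ⁆-∷ʳ n)

∪-monoʳ-⊆ : ν ⊆ l → σ ∪ ν ⊆ σ ∪ l
∪-monoʳ-⊆ {ν = ν} {σ = σ} ν⊆l p with x∈p∪q⁻ σ ν p
... | inj₁ x∈σ = x∈p∪q⁺ (inj₁ x∈σ)
... | inj₂ x∈ν = x∈p∪q⁺ (inj₂ (ν⊆l x∈ν))

-- Complexes on one more vertex

-- Level-polymorphic, so that they also apply to the union of a list of complexes.
lift : ∀ {ℓ} → (Subset n → Set ℓ) → Subset (suc n) → Set ℓ
lift K s = ∃[ t ] (s ≡ t ∷ʳ outside × K t)

-- Not the cone over K: K with the cone from the new vertex over the simplex M glued on.
cone : ∀ {ℓ} → Subset n → (Subset n → Set ℓ) → Subset (suc n) → Set ℓ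
cone M K s = lift K s ⊎ ∃[ t ] (t ⊆ M × s ≡ t ∷ʳ inside)

apex : Complex (suc n)
apex {n} s = s ≡ ⁅ fromℕ n ⁆

lift-∷ʳ⁻ : lift K (t ∷ʳ b) → b ≡ outside × K t
lift-∷ʳ⁻ {t = t} (t' , e , Kt') with ∷ʳ-injective t t' e
... | refl , refl = refl , Kt'

lift-Facet⁺ : Facet K σ → Facet (lift K) (σ ∷ʳ outside)
lift-Facet⁺ {K = K} {σ = σ} (neσ , Kσ , maxσ) = ∷ʳ-Nonempty⁺ neσ , (σ , refl , Kσ) , max
  where
  max : ∀ ρ → lift K ρ → σ ∷ʳ outside ⊆ ρ → ρ ≡ σ ∷ʳ outside
  max _ (r , refl , Kr) σ⊆r = cong (_∷ʳ outside) (maxσ r Kr (drop-∷ʳ-⊆ σ⊆r))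

lift-Facet⁻ : Facet (lift K) (σ ∷ʳ outside) → Facet K σ
lift-Facet⁻ {K = K} {σ = σ} (neσ , Kσ , maxσ) =
  ∷ʳ-outside-Nonempty⁻ neσ , proj₂ (lift-∷ʳ⁻ Kσ) , max
  where
  max : ∀ ρ → K ρ → σ ⊆ ρ → ρ ≡ σ
  max ρ Kρ σ⊆ρ = ∷ʳ-injectiveˡ ρ σ (maxσ (ρ ∷ʳ outside) (ρ , refl , Kρ) (∷ʳ-mono σ⊆ρ))

lift-↘ : ElemCollapse K K' → ElemCollapse (lift K) (lift K')
lift-↘ {K = K} {K' = K'} (σ , τ , facet , neτ , τ⊆σ , τ≢σ , free , K'⇔) =
  σ ∷ʳ outside , τ ∷ʳ outside , lift-Facet⁺ facet , ∷ʳ-Nonempty⁺ neτ , ∷ʳ-mono τ⊆σ ,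
  τ≢σ ∘ ∷ʳ-injectiveˡ τ σ , free' , λ s nes → mk⇔ (to' nes) (from' nes)
  where
  free' : ∀ ρ → Facet (lift K) ρ → τ ∷ʳ outside ⊆ ρ → ρ ≡ σ ∷ʳ outside
  free' _ f@(_ , (r , refl , _) , _) τ⊆r =
    cong (_∷ʳ outside) (free r (lift-Facet⁻ f) (drop-∷ʳ-⊆ τ⊆r))
  to' : Nonempty s → lift K' s → lift K s × ¬ (τ ∷ʳ outside ⊆ s × s ⊆ σ ∷ʳ outside)
  to' nes (t , refl , K't) with to (K'⇔ t (∷ʳ-outside-Nonempty⁻ nes)) K't
  ... | Kt , notBetween =
    (t , refl , Kt) , λ (τ⊆ , ⊆σ) → notBetween (drop-∷ʳ-⊆ τ⊆ , drop-∷ʳ-⊆ ⊆σ)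
  from' : Nonempty s → lift K s × ¬ (τ ∷ʳ outside ⊆ s × s ⊆ σ ∷ʳ outside) → lift K' s
  from' nes ((t , refl , Kt) , notBetween) =
    t , refl , from (K'⇔ t (∷ʳ-outside-Nonempty⁻ nes))
                 (Kt , λ (τ⊆ , ⊆σ) → notBetween (∷ʳ-mono τ⊆ , ∷ʳ-mono ⊆σ))

lift-↘* : Star ElemCollapse K K' → Star ElemCollapse (lift K) (lift K')
lift-↘* ε = ε
lift-↘* (step ◅ steps) = lift-↘ step ◅ lift-↘* steps

lift-IsPoint : IsPoint K → IsPoint (lift K)
lift-IsPoint {K = K} (v , K⇔v) = inject₁ v , λ s nes → mk⇔ (to' nes) from'
  where
  to' : Nonempty s → lift K s → s ≡ ⁅ inject₁ v ⁆
  to' nes (t , refl , Kt) =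
    trans (cong (_∷ʳ outside) (to (K⇔v t (∷ʳ-outside-Nonempty⁻ nes)) Kt)) (sym (⁅inject₁⁆-∷ʳ v))
  from' : s ≡ ⁅ inject₁ v ⁆ → lift K s
  from' refl = ⁅ v ⁆ , ⁅inject₁⁆-∷ʳ v , from (K⇔v ⁅ v ⁆ (v , x∈⁅x⁆ v)) refl

IsPoint⇒Collapsible : IsPoint K → Collapsible K
IsPoint⇒Collapsible point = _ , ε , point

lift-Collapsible : Collapsible K → Collapsible (lift K)
lift-Collapsible (K' , steps , point) = lift K' , lift-↘* steps , lift-IsPoint point

-- The new vertex is a free face of the facet M ∪ {n+1} of the cone.
cone-↘-lift : Nonempty M → ElemCollapse (cone M K) (lift K)
cone-↘-lift {n} {M} {K} (x , x∈M) =
  M ∷ʳ inside , S.⊥ ∷ʳ inside ,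
  ((fromℕ n , fromℕ∈∷ʳ⁺) , inj₂ (M , ⊆-refl , refl) , maxM) ,
  (fromℕ n , fromℕ∈∷ʳ⁺) , ∷ʳ-mono ⊥⊆ , ⊥≢M , free , λ s _ → mk⇔ to' from'
  where
  maxM : ∀ ρ → cone M K ρ → M ∷ʳ inside ⊆ ρ → ρ ≡ M ∷ʳ inside
  maxM _ (inj₁ (_ , refl , _)) M⊆ρ = contradiction (∷ʳ-inside-⊆ M⊆ρ) λ ()
  maxM _ (inj₂ (t , t⊆M , refl)) M⊆ρ = ⊆-antisym (∷ʳ-mono t⊆M) M⊆ρ
  ⊥≢M : S.⊥ ∷ʳ inside ≢ M ∷ʳ inside
  ⊥≢M e = ∉⊥ (subst (x ∈_) (sym (∷ʳ-injectiveˡ S.⊥ M e)) x∈M)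
  free : ∀ ρ → Facet (cone M K) ρ → S.⊥ ∷ʳ inside ⊆ ρ → ρ ≡ M ∷ʳ inside
  free _ (_ , inj₁ (_ , refl , _) , _) ⊥⊆ρ = contradiction (∷ʳ-inside-⊆ ⊥⊆ρ) λ ()
  free _ (_ , inj₂ (t , t⊆M , refl) , maxρ) _ =
    sym (maxρ (M ∷ʳ inside) (inj₂ (M , ⊆-refl , refl)) (∷ʳ-mono t⊆M))
  to' : lift K s → cone M K s × ¬ (S.⊥ ∷ʳ inside ⊆ s × s ⊆ M ∷ʳ inside)
  to' l@(_ , refl , _) = inj₁ l , λ (⊥⊆s , _) → contradiction (∷ʳ-inside-⊆ ⊥⊆s) λ ()
  from' : cone M K s × ¬ (S.⊥ ∷ʳ inside ⊆ s × s ⊆ M ∷ʳ inside) → lift K s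
  from' (inj₁ l , _) = l
  from' (inj₂ (t , t⊆M , refl) , notBetween) =
    contradiction ((λ {_} → ∷ʳ-mono ⊥⊆) , (λ {_} → ∷ʳ-mono t⊆M)) notBetween

cone-Collapsible : Nonempty M → Collapsible K → Collapsible (cone M K)
cone-Collapsible neM (K' , steps , point) =
  lift K' , cone-↘-lift neM ◅ lift-↘* steps , lift-IsPoint point

apex-Collapsible : Collapsible (apex {n})
apex-Collapsible {n} = IsPoint⇒Collapsible (fromℕ n , λ s _ → mk⇔ id id)

VertexDisjoint-sym : VertexDisjoint K L → VertexDisjoint L K
VertexDisjoint-sym disj s t Ls Kt ne = disj t s Kt Ls (subst Nonempty (∩-comm s t) ne)

lift-VertexDisjoint : VertexDisjoint K L → VertexDisjoint (lift K) (lift L)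
lift-VertexDisjoint disj _ _ (s , refl , Ks) (t , refl , Lt) ne =
  disj s t Ks Lt (∷ʳ-outside-∩-Nonempty⁻ ne)

cone-VertexDisjoint : VertexDisjoint K L → K M → VertexDisjoint (cone M K) (lift L)
cone-VertexDisjoint disj KM s t (inj₁ l) l' ne = lift-VertexDisjoint disj s t l l' ne
cone-VertexDisjoint {M = M} disj KM _ _ (inj₂ (s , s⊆M , refl)) (t , refl , Lt) ne
  with ∷ʳ-outside-∩-Nonempty⁻ ne
... | x , p with x∈p∩q⁻ s t p
... | x∈s , x∈t = disj M t KM Lt (x , x∈p∩q⁺ (s⊆M x∈s , x∈t))

apex-VertexDisjoint : VertexDisjoint apex (lift K)
apex-VertexDisjoint {n} _ _ refl (t , refl , _) ne
  with ∷ʳ-outside-∩-Nonempty⁻ (subst (λ a → Nonempty (a ∩ (t ∷ʳ outside))) (⁅fromℕ⁆-∷ʳ n) ne)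
... | x , p = ∉⊥ (proj₁ (x∈p∩q⁻ S.⊥ t p))

-- Unions of lists of complexes

⋃ : List (Complex n) → Subset n → Set₁
⋃ Ks s = Any (λ L → L s) Ks

lift-⋃⁺ : ∀ Ks → lift (⋃ Ks) s → ⋃ (map lift Ks) s
lift-⋃⁺ (_ ∷ Ks) (t , refl , here Kt) = here (t , refl , Kt)
lift-⋃⁺ (_ ∷ Ks) (t , refl , there a) = there (lift-⋃⁺ Ks (t , refl , a))

lift-⋃⁻ : ∀ Ks → ⋃ (map lift Ks) s → lift (⋃ Ks) s
lift-⋃⁻ (_ ∷ Ks) (here (t , refl , Kt)) = t , refl , here Kt
lift-⋃⁻ (_ ∷ Ks) (there a) with lift-⋃⁻ Ks a
... | t , refl , a' = t , refl , there a'

cone-mono : ∀ {ℓ ℓ'} {P : Subset n → Set ℓ} {Q : Subset n → Set ℓ'} →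
            (∀ t → Nonempty t → P t → Q t) → Nonempty s → cone M P s → cone M Q s
cone-mono P⊆Q nes (inj₁ (t , refl , Pt)) = inj₁ (t , refl , P⊆Q t (∷ʳ-outside-Nonempty⁻ nes) Pt)
cone-mono P⊆Q nes (inj₂ j) = inj₂ j

cone-cong : ∀ {ℓ ℓ'} {P : Subset n → Set ℓ} {Q : Subset n → Set ℓ'} →
            (∀ t → Nonempty t → P t ⇔ Q t) → Nonempty s → cone M P s ⇔ cone M Q s
cone-cong P⇔Q nes = mk⇔ (cone-mono (λ t ne → to (P⇔Q t ne)) nes)
                        (cone-mono (λ t ne → from (P⇔Q t ne)) nes)

coneAt : {Ks : List (Complex n)} → Any (λ L → L M) Ks → List (Complex (suc n))
coneAt {M = M} {Ks = K ∷ Ks} (here _) = cone M K ∷ map lift Ks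
coneAt {Ks = K ∷ Ks} (there a) = lift K ∷ coneAt a

coneAt-Collapsible : {Ks : List (Complex n)} → Nonempty M → (a : Any (λ L → L M) Ks) →
                     All Collapsible Ks → All Collapsible (coneAt a)
coneAt-Collapsible neM (here _) (coll ∷ colls) =
  cone-Collapsible neM coll ∷ All.map⁺ (All.map lift-Collapsible colls)
coneAt-Collapsible neM (there a) (coll ∷ colls) =
  lift-Collapsible coll ∷ coneAt-Collapsible neM a colls

coneAt-VertexDisjoint : {Ks : List (Complex n)} (a : Any (λ L → L M) Ks) →
                        All (VertexDisjoint K) Ks → All (VertexDisjoint (lift K)) (coneAt a)
coneAt-VertexDisjoint (here LM) (disj ∷ disjs) =
  VertexDisjoint-sym (cone-VertexDisjoint (VertexDisjoint-sym disj) LM)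
    ∷ All.map⁺ (All.map lift-VertexDisjoint disjs)
coneAt-VertexDisjoint (there a) (disj ∷ disjs) =
  lift-VertexDisjoint disj ∷ coneAt-VertexDisjoint a disjs

coneAt-AllPairs : {Ks : List (Complex n)} (a : Any (λ L → L M) Ks) →
                  AllPairs VertexDisjoint Ks → AllPairs VertexDisjoint (coneAt a)
coneAt-AllPairs (here KM) (disjs ∷ pairs) =
  All.map⁺ (All.map (λ disj → cone-VertexDisjoint disj KM) disjs)
    ∷ AllPairs.map⁺ (AllPairs.map lift-VertexDisjoint pairs)
coneAt-AllPairs (there a) (disjs ∷ pairs) =
  coneAt-VertexDisjoint a disjs ∷ coneAt-AllPairs a pairs

coneAt-⋃⁺ : {Ks : List (Complex n)} (a : Any (λ L → L M) Ks) → cone M (⋃ Ks) s → ⋃ (coneAt a) s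
coneAt-⋃⁺ (here _) (inj₁ (t , refl , here Kt)) = here (inj₁ (t , refl , Kt))
coneAt-⋃⁺ {Ks = _ ∷ Ks} (here _) (inj₁ (t , refl , there b)) = there (lift-⋃⁺ Ks (t , refl , b))
coneAt-⋃⁺ (here _) (inj₂ j) = here (inj₂ j)
coneAt-⋃⁺ (there a) (inj₁ (t , refl , here Kt)) = here (t , refl , Kt)
coneAt-⋃⁺ (there a) (inj₁ (t , refl , there b)) = there (coneAt-⋃⁺ a (inj₁ (t , refl , b)))
coneAt-⋃⁺ (there a) (inj₂ j) = there (coneAt-⋃⁺ a (inj₂ j))

coneAt-⋃⁻ : {Ks : List (Complex n)} (a : Any (λ L → L M) Ks) → ⋃ (coneAt a) s → cone M (⋃ Ks) s
coneAt-⋃⁻ (here _) (here (inj₁ (t , refl , Kt))) = inj₁ (t , refl , here Kt)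
coneAt-⋃⁻ (here _) (here (inj₂ j)) = inj₂ j
coneAt-⋃⁻ {Ks = _ ∷ Ks} (here _) (there b) with lift-⋃⁻ Ks b
... | t , refl , b' = inj₁ (t , refl , there b')
coneAt-⋃⁻ (there a) (here (t , refl , Kt)) = inj₁ (t , refl , here Kt)
coneAt-⋃⁻ (there a) (there b) with coneAt-⋃⁻ a b
... | inj₁ (t , refl , b') = inj₁ (t , refl , there b')
... | inj₂ j = inj₂ j

apex-⋃⁺ : ∀ Ks → Empty M → cone M (⋃ Ks) s → ⋃ (apex ∷ map lift Ks) s
apex-⋃⁺ Ks emptyM (inj₁ l) = there (lift-⋃⁺ Ks l)
apex-⋃⁺ {n} Ks emptyM (inj₂ (t , t⊆M , refl)) =
  here (trans (cong (_∷ʳ inside) (Empty-unique (emptyM ∘ λ (x , x∈t) → x , t⊆M x∈t)))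
              (sym (⁅fromℕ⁆-∷ʳ n)))

apex-⋃⁻ : ∀ Ks → ⋃ (apex ∷ map lift Ks) s → cone M (⋃ Ks) s
apex-⋃⁻ {n} Ks (here refl) = inj₂ (S.⊥ , ⊥⊆ , ⁅fromℕ⁆-∷ʳ n)
apex-⋃⁻ Ks (there a) = inj₁ (lift-⋃⁻ Ks a)

DisjointUnionOfCollapsible-cong : (∀ s → Nonempty s → K s ⇔ L s) →
                                  DisjointUnionOfCollapsible L → DisjointUnionOfCollapsible K
DisjointUnionOfCollapsible-cong K⇔L (Ks , colls , pairs , L⇔⋃) =
  Ks , colls , pairs , λ s nes → ⇔-trans (K⇔L s nes) (L⇔⋃ s nes)

IsPoint⇒DisjointUnionOfCollapsible : IsPoint K → DisjointUnionOfCollapsible K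
IsPoint⇒DisjointUnionOfCollapsible {K = K} point =
  K ∷ [] , IsPoint⇒Collapsible point ∷ [] , [] ∷ [] , λ _ _ → mk⇔ here λ { (here Ks) → Ks }

cone-DisjointUnionOfCollapsible : (M : Subset n) → K M →
  DisjointUnionOfCollapsible K → DisjointUnionOfCollapsible (cone M K)
cone-DisjointUnionOfCollapsible M KM (Ks , colls , pairs , K⇔⋃) with nonempty? M
... | yes neM =
  coneAt a , coneAt-Collapsible neM a colls , coneAt-AllPairs a pairs ,
  λ s nes → ⇔-trans (cone-cong K⇔⋃ nes) (mk⇔ (coneAt-⋃⁺ a) (coneAt-⋃⁻ a))
  where
  a : Any (λ L → L M) Ks
  a = to (K⇔⋃ M neM) KM
... | no ¬neM =
  apex ∷ map lift Ks ,
  apex-Collapsible ∷ All.map⁺ (All.map lift-Collapsible colls) ,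
  All.map⁺ (All.map (λ _ → apex-VertexDisjoint) colls)
    ∷ AllPairs.map⁺ (AllPairs.map lift-VertexDisjoint pairs) ,
  λ s nes → ⇔-trans (cone-cong K⇔⋃ nes) (mk⇔ (apex-⋃⁺ Ks ¬neM) (apex-⋃⁻ Ks))

Δ-cong : {C D : Code n} → (∀ w → C w ⇔ D w) → ∀ s → Δ C s ⇔ Δ D s
Δ-cong C⇔D s = mk⇔ (λ (c , Cc , s⊆c) → c , to (C⇔D c) Cc , s⊆c)
                   (λ (c , Dc , s⊆c) → c , from (C⇔D c) Dc , s⊆c)

Δ-Piercing : {C : Code n} → (∀ ν → ν ⊆ l → C (σ ∪ ν)) →
             ∀ s → Δ (Piercing C l σ) s ⇔ cone (σ ∪ l) (Δ C) s
Δ-Piercing {l = l} {σ = σ} {C = C} σ∪ν∈C s with initLast s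
... | t , b , refl = mk⇔ (to' b) from'
  where
  to' : ∀ b → Δ (Piercing C l σ) (t ∷ʳ b) → cone (σ ∪ l) (Δ C) (t ∷ʳ b)
  to' inside (_ , inj₁ (_ , refl , _) , t⊆c) = contradiction (∷ʳ-inside-⊆ t⊆c) λ ()
  to' outside (_ , inj₁ (c , refl , Cc) , t⊆c) = inj₁ (t , refl , c , Cc , drop-∷ʳ-⊆ t⊆c)
  to' inside (_ , inj₂ (ν , ν⊆l , refl) , t⊆σ∪ν) =
    inj₂ (t , ⊆-trans (drop-∷ʳ-⊆ t⊆σ∪ν) (∪-monoʳ-⊆ ν⊆l) , refl)
  to' outside (_ , inj₂ (ν , ν⊆l , refl) , t⊆σ∪ν) =
    inj₁ (t , refl , σ ∪ ν , σ∪ν∈C ν ν⊆l , drop-∷ʳ-⊆ t⊆σ∪ν)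
  from' : cone (σ ∪ l) (Δ C) s' → Δ (Piercing C l σ) s'
  from' (inj₁ (_ , refl , c , Cc , u⊆c)) = c ∷ʳ outside , inj₁ (c , refl , Cc) , ∷ʳ-mono u⊆c
  from' (inj₂ (_ , u⊆σ∪l , refl)) = (σ ∪ l) ∷ʳ inside , inj₂ (l , ⊆-refl , refl) , ∷ʳ-mono u⊆σ∪l

Δ-IsPoint : {C : Code 1} → (∀ w → C w ⇔ (w ≡ S.⊥ ⊎ w ≡ ⁅ zero ⁆)) → IsPoint (Δ C)
Δ-IsPoint {C} C⇔ = zero , λ s nes → mk⇔ (to' s nes) from'
  where
  to' : ∀ s → Nonempty s → Δ C s → s ≡ ⁅ zero ⁆
  to' s (x , x∈s) (c , Cc , s⊆c) with to (C⇔ c) Cc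
  ... | inj₁ refl = contradiction (s⊆c x∈s) ∉⊥
  to' (inside ∷ []) _ _ | inj₂ refl = refl
  to' (outside ∷ []) (zero , ()) _ | inj₂ refl
  from' : s ≡ ⁅ zero ⁆ → Δ C s
  from' refl = ⁅ zero ⁆ , from (C⇔ _) (inj₂ refl) , ⊆-refl

IndPierced⇒DisjointUnionOfCollapsible : ∀ {k} {C : Code n} → IndPierced k n C →
                                        DisjointUnionOfCollapsible (Δ C)
IndPierced⇒DisjointUnionOfCollapsible (base C C⇔) =
  IsPoint⇒DisjointUnionOfCollapsible (Δ-IsPoint C⇔)
IndPierced⇒DisjointUnionOfCollapsible (pierce C pierced l σ (_ , σ∪ν∈C) _ C' C'⇔) =
  DisjointUnionOfCollapsible-cong (λ s _ → ⇔-trans (Δ-cong C'⇔ s) (Δ-Piercing σ∪ν∈C s))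
    (cone-DisjointUnionOfCollapsible (σ ∪ l) (σ ∪ l , σ∪ν∈C l ⊆-refl , λ {_} → ⊆-refl)
      (IndPierced⇒DisjointUnionOfCollapsible pierced))

corollary3p5 : (n : ℕ) (C : Code n) → InductivelyPierced C → DisjointUnionOfCollapsible (Δ C)
corollary3p5 n C (_ , pierced) = IndPierced⇒DisjointUnionOfCollapsible pierced
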